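{- Let $\vec G_0=\vec G$ be a weighted directed graph on $V$, let $\beta\ge1$, and suppose that for some $k$ and all $i\in[k]$, $\vec G_i$ is a $(\beta,\epsilon_i)$-directed cut approximation of $\vec G_{i-1}$, where $\epsilon_i\in(0,1)$ and $\sum_{i\in[k]}\epsilon_i\le\frac1{\sqrt2}$. Then $\vec G_k$ is a $(\beta,3\sum_{i\in[k]}\epsilon_i)$-balanced directed cut approximation of $\vec G$.
   Context: For a directed graph with weights $w$ on $V$ and $\emptyset\ne U\subsetneq V$, $w(U,V\setminus U)$ is the total weight of edges $(u,v)$ with $u\in U$, $v\notin U$; the directed cut $\vec C=(U,V\setminus U)$ has weight $w(\vec C)=w(U,V\setminus U)$ and its corresponding undirected cut $C$ has weight $w_G(C)=w(U,V\setminus U)+w(V\setminus U,U)$. $\vec H$ is a $(\beta,\epsilon)$-directed cut approximation of $\vec G$ if for every directed cut $\vec C$, $|w_{\vec H}(\vec C)-w_{\vec G}(\vec C)|\le\frac{\epsilon}{\sqrt{\beta+1}}\sqrt{w_{\vec G}(\vec C)\,w_G(C)}$. $\vec H$ is a $(\beta,\epsilon)$-balanced directed cut approximation of $\vec G$ if for every $\emptyset\ne U\subsetneq V$ with $\frac1\beta w_{\vec G}(V\setminus U,U)\le w_{\vec G}(U,V\setminus U)\le\beta\,w_{\vec G}(V\setminus U,U)$, one has $(1-\epsilon)w_{\vec G}(U,V\setminus U)\le w_{\vec H}(U,V\setminus U)\le(1+\epsilon)w_{\vec G}(U,V\setminus U)$.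
   Formalization: The edge weights of all the graphs, the parameter β and the parameters ε_i are rational rather than real. -}

module Defs where

open import Data.Nat using (ℕ; zero; suc)
open import Data.Fin using (Fin; zero; suc)
open import Data.Bool using (Bool; true; false; _∧_; not; if_then_else_)
open import Data.Rational using (ℚ; 0ℚ; 1ℚ; _+_; _*_; _-_; _≤_)
open import Data.Product using (_×_; ∃)
open import Data.Sum using (_⊎_)
open import Relation.Binary.PropositionalEquality using (_≡_)

sumFin : (n : ℕ) → (Fin n → ℚ) → ℚ
sumFin zero    f = 0ℚ
sumFin (suc n) f = f zero + sumFin n (λ i → f (suc i))

-- A weighted directed graph on V = Fin n: w u v is the weight of edge (u,v)
-- (weight 0 = no edge).
Weights : ℕ → Set
Weights n = Fin n → Fin n → ℚ

NonNegWeights : ∀ {n} → Weights n → Set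
NonNegWeights {n} w = ∀ (u v : Fin n) → 0ℚ ≤ w u v

Subset : ℕ → Set
Subset n = Fin n → Bool

compl : ∀ {n} → Subset n → Subset n
compl U i = not (U i)

ProperNonempty : ∀ {n} → Subset n → Set
ProperNonempty U = (∃ λ i → U i ≡ true) × (∃ λ j → U j ≡ false)

wt : ∀ {n} → Weights n → Subset n → Subset n → ℚ
wt {n} w A B = sumFin n (λ u → sumFin n (λ v → if A u ∧ B v then w u v else 0ℚ))

dirCut : ∀ {n} → Weights n → Subset n → ℚ
dirCut w U = wt w U (compl U)

undirCut : ∀ {n} → Weights n → Subset n → ℚ
undirCut w U = dirCut w U + dirCut w (compl U)

-- |d| ≤ (c / √b) · √y, for b > 0 and y ≥ 0, written without square roots:
-- if c ≥ 0 it is d²·b ≤ c²·y; if c < 0 the right side is ≤ 0, so it holds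
-- iff d = 0 and c²·y = 0.
AbsLeScaledSqrt : (d c b y : ℚ) → Set
AbsLeScaledSqrt d c b y =
  (0ℚ ≤ c × (d * d) * b ≤ (c * c) * y) ⊎ (d ≡ 0ℚ × (c * c) * y ≡ 0ℚ)

-- H is a (β,ε)-directed cut approximation of G:
-- ∀ directed cut C, |w_H(C) - w_G(C)| ≤ ε/√(β+1) · √(w_G(C) · w_G(undirected C)).
DirCutApprox : ∀ {n} → (β ε : ℚ) → (G H : Weights n) → Set
DirCutApprox {n} β ε G H = ∀ (U : Subset n) → ProperNonempty U →
  AbsLeScaledSqrt (dirCut H U - dirCut G U) ε (β + 1ℚ) (dirCut G U * undirCut G U)

-- H is a (β,ε)-balanced directed cut approximation of G:
-- for every U with (1/β) w_G(V∖U,U) ≤ w_G(U,V∖U) ≤ β w_G(V∖U,U)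
-- (the first inequality written multiplied through by β > 0),
-- (1-ε) w_G(U,V∖U) ≤ w_H(U,V∖U) ≤ (1+ε) w_G(U,V∖U).
BalancedDirCutApprox : ∀ {n} → (β ε : ℚ) → (G H : Weights n) → Set
BalancedDirCutApprox {n} β ε G H = ∀ (U : Subset n) → ProperNonempty U →
  dirCut G (compl U) ≤ β * dirCut G U →
  dirCut G U ≤ β * dirCut G (compl U) →
  ((1ℚ - ε) * dirCut G U ≤ dirCut H U) × (dirCut H U ≤ (1ℚ + ε) * dirCut G U)

2ℚ 3ℚ : ℚ
2ℚ = 1ℚ + 1ℚ
3ℚ = 2ℚ + 1ℚ

-- Fix a cut U, write D = w_G(U,V∖U) and u₀ for the undirected weight of U in G; balance gives
-- u₀ ≤ (β+1)D.  Along the chain, with T = ε₁ + ⋯ + εᵢ, we keep the invariant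
--   |d − D| ≤ 3TD   and   u ≤ (1 + T + T²) u₀,
-- where d and u are the directed and undirected weights of U in Gᵢ.  A step with error ε moves d
-- by at most ε √(d u / (β+1)) ≤ ε D √((1+3T)(1+T+T²)), which is ≤ 3εD since 2T² ≤ 1.  Adding the
-- moves of both directions and using (a + b)² ≤ 2(a² + b²) ≤ (β+1)(a² + b²), u grows by a factor
-- of at most 1 + ε, and (1 + ε)(1 + T + T²) ≤ 1 + (T+ε) + (T+ε)² as T ≤ 1.
-- All square roots are avoided by squaring.
{-# OPTIONS --safe #-}
module Submission where

open import Defs
open import Data.Nat using (ℕ; zero; suc)
open import Data.Fin using (Fin; zero; suc; inject₁; fromℕ)
open import Data.Rational using (ℚ; 0ℚ; 1ℚ; _+_; _*_; _-_; -_; ∣_∣; _≤_; _<_; nonNegative; positive)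
open import Data.Product using (_×_; _,_; proj₁; proj₂)

open import Data.Bool using (true; false; _∧_; not; if_then_else_)
open import Data.Bool.Properties using (not-involutive)
open import Data.Empty using (⊥-elim)
open import Data.List using (_∷_; [])
open import Data.Maybe using (Maybe; just; nothing)
open import Data.Rational.Properties
open import Data.Sum using (inj₁; inj₂)
open import Function using (_∘_)
open import Level using (0ℓ)
open import Relation.Binary.PropositionalEquality
open import Relation.Nullary using (yes; no)
open import Tactic.RingSolver using (solve)
open import Tactic.RingSolver.Core.AlmostCommutativeRing using (AlmostCommutativeRing; fromCommutativeRing)

ℚ-ring : AlmostCommutativeRing 0ℓ 0ℓ
ℚ-ring = fromCommutativeRing +-*-commutativeRing 0≟
  where
  0≟ : ∀ p → Maybe (0ℚ ≡ p)
  0≟ p with 0ℚ ≟ p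
  ... | yes 0≡p = just 0≡p
  ... | no _    = nothing

open ≤-Reasoning

private
  variable
    p q r s : ℚ

0≤1 : 0ℚ ≤ 1ℚ
0≤1 = nonNegative⁻¹ 1ℚ

≤-by-slack : 0ℚ ≤ s → p + s ≡ q → p ≤ q
≤-by-slack {s} {p} 0≤s refl = begin
  p       ≡⟨ +-identityʳ p ⟨
  p + 0ℚ  ≤⟨ +-monoʳ-≤ p 0≤s ⟩
  p + s   ∎

p≤q⇒0≤q-p : p ≤ q → 0ℚ ≤ q - p
p≤q⇒0≤q-p {p} {q} p≤q = begin
  0ℚ     ≡⟨ +-inverseʳ p ⟨
  p - p  ≤⟨ +-monoˡ-≤ (- p) p≤q ⟩
  q - p  ∎

*-nonNeg : 0ℚ ≤ p → 0ℚ ≤ q → 0ℚ ≤ p * q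
*-nonNeg {p} {q} 0≤p 0≤q =
  nonNegative⁻¹ (p * q) {{nonNeg*nonNeg⇒nonNeg p {{nonNegative 0≤p}} q {{nonNegative 0≤q}}}}

*-mono-≤-nonNeg : 0ℚ ≤ p → 0ℚ ≤ r → p ≤ q → r ≤ s → p * r ≤ q * s
*-mono-≤-nonNeg {p} {r} {q} {s} 0≤p 0≤r p≤q r≤s = begin
  p * r  ≤⟨ *-monoʳ-≤-nonNeg r {{nonNegative 0≤r}} p≤q ⟩
  q * r  ≤⟨ *-monoˡ-≤-nonNeg q {{nonNegative (≤-trans 0≤p p≤q)}} r≤s ⟩
  q * s  ∎

∣p∣*∣p∣≡p*p : ∀ p → ∣ p ∣ * ∣ p ∣ ≡ p * p
∣p∣*∣p∣≡p*p p with ∣p∣≡p∨∣p∣≡-p p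
... | inj₁ ∣p∣≡p  rewrite ∣p∣≡p  = refl
... | inj₂ ∣p∣≡-p rewrite ∣p∣≡-p = solve (p ∷ []) ℚ-ring

p*p-nonNeg : ∀ p → 0ℚ ≤ p * p
p*p-nonNeg p = subst (0ℚ ≤_) (∣p∣*∣p∣≡p*p p) (*-nonNeg (0≤∣p∣ p) (0≤∣p∣ p))

p≤∣p∣ : ∀ p → p ≤ ∣ p ∣
p≤∣p∣ p with 0ℚ ≤? p
... | yes 0≤p = ≤-reflexive (sym (0≤p⇒∣p∣≡p 0≤p))
... | no  0≰p = ≤-trans (<⇒≤ (≰⇒> 0≰p)) (0≤∣p∣ p)

-∣p∣≤p : ∀ p → - ∣ p ∣ ≤ p
-∣p∣≤p p = begin
  - ∣ p ∣    ≡⟨ cong -_ (∣-p∣≡∣p∣ p) ⟨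
  - ∣ - p ∣  ≤⟨ neg-antimono-≤ (p≤∣p∣ (- p)) ⟩
  - - p      ≡⟨ solve (p ∷ []) ℚ-ring ⟩
  p          ∎

∣p-q∣≤r⇒q-r≤p≤q+r : ∣ p - q ∣ ≤ r → q - r ≤ p × p ≤ q + r
∣p-q∣≤r⇒q-r≤p≤q+r {p} {q} {r} ∣p-q∣≤r = lower , upper
  where
  lower : q - r ≤ p
  lower = begin
    q - r          ≤⟨ +-monoʳ-≤ q (neg-antimono-≤ ∣p-q∣≤r) ⟩
    q - ∣ p - q ∣  ≤⟨ +-monoʳ-≤ q (-∣p∣≤p (p - q)) ⟩
    q + (p - q)    ≡⟨ solve (p ∷ q ∷ []) ℚ-ring ⟩
    p              ∎
  upper : p ≤ q + r
  upper = begin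
    p              ≡⟨ solve (p ∷ q ∷ []) ℚ-ring ⟩
    q + (p - q)    ≤⟨ +-monoʳ-≤ q (≤-trans (p≤∣p∣ (p - q)) ∣p-q∣≤r) ⟩
    q + r          ∎

p*p≤r*r⇒∣p∣≤r : 0ℚ ≤ r → p * p ≤ r * r → ∣ p ∣ ≤ r
p*p≤r*r⇒∣p∣≤r {r} {p} 0≤r p*p≤r*r with ∣ p ∣ ≤? r
... | yes ∣p∣≤r = ∣p∣≤r
... | no  ∣p∣≰r = ⊥-elim (<-irrefl refl r*r<r*r)
  where
  r<∣p∣ : r < ∣ p ∣
  r<∣p∣ = ≰⇒> ∣p∣≰r
  r*r<r*r : r * r < r * r
  r*r<r*r = begin-strict
    r * r          ≤⟨ *-monoʳ-≤-nonNeg r {{nonNegative 0≤r}} (<⇒≤ r<∣p∣) ⟩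
    ∣ p ∣ * r      <⟨ *-monoʳ-<-pos ∣ p ∣ {{positive (≤-<-trans 0≤r r<∣p∣)}} r<∣p∣ ⟩
    ∣ p ∣ * ∣ p ∣  ≡⟨ ∣p∣*∣p∣≡p*p p ⟩
    p * p          ≤⟨ p*p≤r*r ⟩
    r * r          ∎

p*p*2≤1⇒p≤1 : p * p * 2ℚ ≤ 1ℚ → p ≤ 1ℚ
p*p*2≤1⇒p≤1 {p} p*p*2≤1 = ≤-trans (p≤∣p∣ p) (p*p≤r*r⇒∣p∣≤r 0≤1 (begin
  p * p       ≤⟨ ≤-by-slack (p*p-nonNeg p) (solve (p ∷ []) ℚ-ring) ⟩
  p * p * 2ℚ  ≤⟨ p*p*2≤1 ⟩
  1ℚ * 1ℚ     ∎))

p*p*2≤1-antimono : 0ℚ ≤ p → p ≤ q → q * q * 2ℚ ≤ 1ℚ → p * p * 2ℚ ≤ 1ℚ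
p*p*2≤1-antimono 0≤p p≤q q*q*2≤1 =
  ≤-trans (*-monoʳ-≤-nonNeg 2ℚ (*-mono-≤-nonNeg 0≤p 0≤p p≤q p≤q)) q*q*2≤1

undirected-growth-step : ∀ {T e} → 0ℚ ≤ T → T ≤ 1ℚ → 0ℚ ≤ e →
  (1ℚ + e) * (1ℚ + T + T * T) ≤ 1ℚ + (T + e) + (T + e) * (T + e)
undirected-growth-step {T} {e} 0≤T T≤1 0≤e =
  ≤-by-slack (*-nonNeg 0≤e (+-mono-≤ (*-nonNeg 0≤T (p≤q⇒0≤q-p T≤1)) 0≤e))
             (solve (T ∷ e ∷ []) ℚ-ring)

directed-growth-bound : ∀ {T} → 0ℚ ≤ T → T * T * 2ℚ ≤ 1ℚ →
  (1ℚ + 3ℚ * T) * (1ℚ + T + T * T) ≤ 3ℚ * 3ℚ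
directed-growth-bound {T} 0≤T T*T*2≤1 = *-cancelʳ-≤-pos 2ℚ (≤-by-slack slack (solve (T ∷ []) ℚ-ring))
  where
  4ℚ 11ℚ : ℚ
  4ℚ  = 2ℚ * 2ℚ
  11ℚ = 3ℚ * 3ℚ + 2ℚ
  0≤1-T : 0ℚ ≤ 1ℚ - T
  0≤1-T = p≤q⇒0≤q-p (p*p*2≤1⇒p≤1 {T} T*T*2≤1)
  0≤1-2T² : 0ℚ ≤ 1ℚ - T * T * 2ℚ
  0≤1-2T² = p≤q⇒0≤q-p T*T*2≤1
  slack : 0ℚ ≤ 1ℚ + 11ℚ * (1ℚ - T) + 4ℚ * (1ℚ - T * T * 2ℚ) + 3ℚ * T * (1ℚ - T * T * 2ℚ)
  slack = +-mono-≤ (+-mono-≤ (+-mono-≤ 0≤1 (*-nonNeg (nonNegative⁻¹ 11ℚ) 0≤1-T))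
                             (*-nonNeg (nonNegative⁻¹ 4ℚ) 0≤1-2T²))
                   (*-nonNeg (*-nonNeg (nonNegative⁻¹ 3ℚ) 0≤T) 0≤1-2T²)

directed-drift : ∀ {β e T D d d' x} → 1ℚ ≤ β → 0ℚ ≤ e → 0ℚ ≤ T → T * T * 2ℚ ≤ 1ℚ →
  0ℚ ≤ D → 0ℚ ≤ d → 0ℚ ≤ d + d' →
  d ≤ (1ℚ + 3ℚ * T) * D → d + d' ≤ (1ℚ + T + T * T) * ((β + 1ℚ) * D) →
  x * x * (β + 1ℚ) ≤ e * e * (d * (d + d')) → ∣ x ∣ ≤ 3ℚ * e * D
directed-drift {β} {e} {T} {D} {d} {d'} {x} 1≤β 0≤e 0≤T T*T*2≤1 0≤D 0≤d 0≤d+d' d≤ d+d'≤ x²≤ =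
  p*p≤r*r⇒∣p∣≤r 0≤3eD (*-cancelʳ-≤-pos (β + 1ℚ) {{positive 0<β+1}} (begin
    x * x * (β + 1ℚ)
      ≤⟨ x²≤ ⟩
    e * e * (d * (d + d'))
      ≤⟨ *-monoˡ-≤-nonNeg (e * e) {{nonNegative (p*p-nonNeg e)}}
                           (*-mono-≤-nonNeg 0≤d 0≤d+d' d≤ d+d'≤) ⟩
    e * e * ((1ℚ + 3ℚ * T) * D * ((1ℚ + T + T * T) * ((β + 1ℚ) * D)))
      ≡⟨ solve (β ∷ e ∷ T ∷ D ∷ []) ℚ-ring ⟩
    (1ℚ + 3ℚ * T) * (1ℚ + T + T * T) * (e * e * D * D * (β + 1ℚ))
      ≤⟨ *-monoʳ-≤-nonNeg (e * e * D * D * (β + 1ℚ)) {{nonNegative 0≤e²D²[β+1]}}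
                           (directed-growth-bound 0≤T T*T*2≤1) ⟩
    3ℚ * 3ℚ * (e * e * D * D * (β + 1ℚ))
      ≡⟨ solve (β ∷ e ∷ D ∷ []) ℚ-ring ⟩
    3ℚ * e * D * (3ℚ * e * D) * (β + 1ℚ)  ∎))
  where
  0<β+1 : 0ℚ < β + 1ℚ
  0<β+1 = +-mono-≤-< (≤-trans 0≤1 1≤β) (positive⁻¹ 1ℚ)
  0≤3eD : 0ℚ ≤ 3ℚ * e * D
  0≤3eD = *-nonNeg (*-nonNeg (nonNegative⁻¹ 3ℚ) 0≤e) 0≤D
  0≤e²D²[β+1] : 0ℚ ≤ e * e * D * D * (β + 1ℚ)
  0≤e²D²[β+1] = *-nonNeg (*-nonNeg (*-nonNeg (p*p-nonNeg e) 0≤D) 0≤D) (<⇒≤ 0<β+1)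

undirected-drift : ∀ {β e d d' x y} → 1ℚ ≤ β → 0ℚ ≤ e → 0ℚ ≤ d + d' →
  x * x * (β + 1ℚ) ≤ e * e * (d * (d + d')) → y * y * (β + 1ℚ) ≤ e * e * (d' * (d + d')) →
  x + y ≤ e * (d + d')
undirected-drift {β} {e} {d} {d'} {x} {y} 1≤β 0≤e 0≤d+d' x²≤ y²≤ =
  ≤-trans (p≤∣p∣ (x + y)) (p*p≤r*r⇒∣p∣≤r (*-nonNeg 0≤e 0≤d+d') (begin
    (x + y) * (x + y)
      ≤⟨ ≤-by-slack (p*p-nonNeg (x - y)) (solve (x ∷ y ∷ []) ℚ-ring) ⟩
    (x * x + y * y) * 2ℚ
      ≤⟨ *-monoˡ-≤-nonNeg (x * x + y * y) {{nonNegative (+-mono-≤ (p*p-nonNeg x) (p*p-nonNeg y))}}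
                           (+-monoˡ-≤ 1ℚ 1≤β) ⟩
    (x * x + y * y) * (β + 1ℚ)
      ≡⟨ solve (β ∷ x ∷ y ∷ []) ℚ-ring ⟩
    x * x * (β + 1ℚ) + y * y * (β + 1ℚ)
      ≤⟨ +-mono-≤ x²≤ y²≤ ⟩
    e * e * (d * (d + d')) + e * e * (d' * (d + d'))
      ≡⟨ solve (e ∷ d ∷ d' ∷ []) ℚ-ring ⟩
    e * (d + d') * (e * (d + d'))  ∎))

record Drift (D u₀ T d u : ℚ) : Set where
  field
    directed   : ∣ d - D ∣ ≤ 3ℚ * T * D
    undirected : u ≤ (1ℚ + T + T * T) * u₀

drift-start : ∀ {D u₀} → Drift D u₀ 0ℚ D u₀
drift-start {D} {u₀} = record
  { directed   = ≤-reflexive (begin-equality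
      ∣ D - D ∣    ≡⟨ cong ∣_∣ (+-inverseʳ D) ⟩
      0ℚ           ≡⟨ solve (D ∷ []) ℚ-ring ⟩
      3ℚ * 0ℚ * D  ∎)
  ; undirected = ≤-reflexive (solve (u₀ ∷ []) ℚ-ring)
  }

drift-bounds : ∀ {D u₀ T d u} → Drift D u₀ T d u → (1ℚ - 3ℚ * T) * D ≤ d × d ≤ (1ℚ + 3ℚ * T) * D
drift-bounds {D} {u₀} {T} {d} {u} drift =
  (begin
    (1ℚ - 3ℚ * T) * D  ≡⟨ solve (T ∷ D ∷ []) ℚ-ring ⟩
    D - 3ℚ * T * D     ≤⟨ proj₁ d-bounds ⟩
    d                  ∎) ,
  (begin
    d                  ≤⟨ proj₂ d-bounds ⟩
    D + 3ℚ * T * D     ≡⟨ solve (T ∷ D ∷ []) ℚ-ring ⟩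
    (1ℚ + 3ℚ * T) * D  ∎)
  where
  d-bounds : D - 3ℚ * T * D ≤ d × d ≤ D + 3ℚ * T * D
  d-bounds = ∣p-q∣≤r⇒q-r≤p≤q+r (Drift.directed drift)

drift-step : ∀ {β e T D u₀ d d' f f'} → 1ℚ ≤ β → 0ℚ ≤ e → 0ℚ ≤ T → T * T * 2ℚ ≤ 1ℚ →
  0ℚ ≤ D → 0ℚ ≤ u₀ → u₀ ≤ (β + 1ℚ) * D → 0ℚ ≤ d → 0ℚ ≤ d' →
  (f - d) * (f - d) * (β + 1ℚ) ≤ e * e * (d * (d + d')) →
  (f' - d') * (f' - d') * (β + 1ℚ) ≤ e * e * (d' * (d + d')) →
  Drift D u₀ T d (d + d') → Drift D u₀ (T + e) f (f + f')
drift-step {β} {e} {T} {D} {u₀} {d} {d'} {f} {f'}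
  1≤β 0≤e 0≤T T*T*2≤1 0≤D 0≤u₀ u₀≤ 0≤d 0≤d' x²≤ y²≤ drift = record
  { directed   = begin
      ∣ f - D ∣                ≡⟨ cong ∣_∣ (solve (f ∷ d ∷ D ∷ []) ℚ-ring) ⟩
      ∣ (f - d) + (d - D) ∣    ≤⟨ ∣p+q∣≤∣p∣+∣q∣ (f - d) (d - D) ⟩
      ∣ f - d ∣ + ∣ d - D ∣    ≤⟨ +-mono-≤ ∣f-d∣≤ directed ⟩
      3ℚ * e * D + 3ℚ * T * D  ≡⟨ solve (e ∷ T ∷ D ∷ []) ℚ-ring ⟩
      3ℚ * (T + e) * D         ∎
  ; undirected = begin
      f + f'
        ≡⟨ solve (d ∷ d' ∷ f ∷ f' ∷ []) ℚ-ring ⟩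
      (d + d') + ((f - d) + (f' - d'))
        ≤⟨ +-monoʳ-≤ (d + d') (undirected-drift {d = d} {d'} {f - d} {f' - d'}
                                                1≤β 0≤e 0≤d+d' x²≤ y²≤) ⟩
      (d + d') + e * (d + d')
        ≡⟨ solve (e ∷ d ∷ d' ∷ []) ℚ-ring ⟩
      (1ℚ + e) * (d + d')
        ≤⟨ *-monoˡ-≤-nonNeg (1ℚ + e) {{nonNegative (+-mono-≤ 0≤1 0≤e)}} undirected ⟩
      (1ℚ + e) * ((1ℚ + T + T * T) * u₀)
        ≡⟨ *-assoc (1ℚ + e) _ u₀ ⟨
      (1ℚ + e) * (1ℚ + T + T * T) * u₀
        ≤⟨ *-monoʳ-≤-nonNeg u₀ {{nonNegative 0≤u₀}}
                             (undirected-growth-step 0≤T (p*p*2≤1⇒p≤1 {T} T*T*2≤1) 0≤e) ⟩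
      (1ℚ + (T + e) + (T + e) * (T + e)) * u₀  ∎
  }
  where
  open Drift drift
  0≤d+d' : 0ℚ ≤ d + d'
  0≤d+d' = +-mono-≤ 0≤d 0≤d'
  0≤1+T+T² : 0ℚ ≤ 1ℚ + T + T * T
  0≤1+T+T² = +-mono-≤ (+-mono-≤ 0≤1 0≤T) (p*p-nonNeg T)
  d+d'≤ : d + d' ≤ (1ℚ + T + T * T) * ((β + 1ℚ) * D)
  d+d'≤ = ≤-trans undirected (*-monoˡ-≤-nonNeg (1ℚ + T + T * T) {{nonNegative 0≤1+T+T²}} u₀≤)
  ∣f-d∣≤ : ∣ f - d ∣ ≤ 3ℚ * e * D
  ∣f-d∣≤ = directed-drift {β} 1≤β 0≤e 0≤T T*T*2≤1 0≤D 0≤d 0≤d+d'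
                          (proj₂ (drift-bounds drift)) d+d'≤ x²≤

sumFin-nonNeg : ∀ n {f : Fin n → ℚ} → (∀ i → 0ℚ ≤ f i) → 0ℚ ≤ sumFin n f
sumFin-nonNeg zero    0≤f = ≤-refl
sumFin-nonNeg (suc n) 0≤f = +-mono-≤ (0≤f zero) (sumFin-nonNeg n (0≤f ∘ suc))

sumFin-cong : ∀ n {f g : Fin n → ℚ} → (∀ i → f i ≡ g i) → sumFin n f ≡ sumFin n g
sumFin-cong zero    f≗g = refl
sumFin-cong (suc n) f≗g = cong₂ _+_ (f≗g zero) (sumFin-cong n (f≗g ∘ suc))

module _ {n} {w : Weights n} where

  wt-nonNeg : NonNegWeights w → ∀ A B → 0ℚ ≤ wt w A B
  wt-nonNeg w-nonNeg A B = sumFin-nonNeg n λ u → sumFin-nonNeg n λ v → entry u v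
    where
    entry : ∀ u v → 0ℚ ≤ (if A u ∧ B v then w u v else 0ℚ)
    entry u v with A u ∧ B v
    ... | true  = w-nonNeg u v
    ... | false = ≤-refl

  dirCut-nonNeg : NonNegWeights w → ∀ U → 0ℚ ≤ dirCut w U
  dirCut-nonNeg w-nonNeg U = wt-nonNeg w-nonNeg U (compl U)

  undirCut-nonNeg : NonNegWeights w → ∀ U → 0ℚ ≤ undirCut w U
  undirCut-nonNeg w-nonNeg U = +-mono-≤ (dirCut-nonNeg w-nonNeg U) (dirCut-nonNeg w-nonNeg (compl U))

  dirCut-compl-compl : ∀ U → dirCut w (compl (compl U)) ≡ dirCut w U
  dirCut-compl-compl U = sumFin-cong n λ u → sumFin-cong n λ v →
    cong (λ b → if b then w u v else 0ℚ)
         (cong₂ _∧_ (not-involutive (U u)) (not-involutive (not (U v))))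

  undirCut-compl : ∀ U → undirCut w (compl U) ≡ undirCut w U
  undirCut-compl U = trans (cong (dirCut w (compl U) +_) (dirCut-compl-compl U))
                           (+-comm (dirCut w (compl U)) (dirCut w U))

ProperNonempty-compl : ∀ {n} {U : Subset n} → ProperNonempty U → ProperNonempty (compl U)
ProperNonempty-compl ((i , Ui) , (j , Uj)) = (j , cong not Uj) , (i , cong not Ui)

AbsLeScaledSqrt⇒square-≤ : ∀ {d c b y} → AbsLeScaledSqrt d c b y → d * d * b ≤ c * c * y
AbsLeScaledSqrt⇒square-≤ (inj₁ (_ , d²b≤c²y)) = d²b≤c²y
AbsLeScaledSqrt⇒square-≤ {b = b} (inj₂ (refl , c²y≡0)) = ≤-reflexive (trans (*-zeroˡ b) (sym c²y≡0))

module Chain {n} {β : ℚ} (1≤β : 1ℚ ≤ β) {G₀ : Weights n} (G₀-nonNeg : NonNegWeights G₀)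
             {U : Subset n} (U-proper : ProperNonempty U)
             (balanced : dirCut G₀ (compl U) ≤ β * dirCut G₀ U) where

  DriftFrom₀ : Weights n → ℚ → Set
  DriftFrom₀ G T = Drift (dirCut G₀ U) (undirCut G₀ U) T (dirCut G U) (undirCut G U)

  undirCut₀-bound : undirCut G₀ U ≤ (β + 1ℚ) * dirCut G₀ U
  undirCut₀-bound = begin
    D + dirCut G₀ (compl U)  ≤⟨ +-monoʳ-≤ D balanced ⟩
    D + β * D                ≡⟨ +-comm D (β * D) ⟩
    β * D + D                ≡⟨ cong (β * D +_) (*-identityˡ D) ⟨
    β * D + 1ℚ * D           ≡⟨ *-distribʳ-+ D β 1ℚ ⟨
    (β + 1ℚ) * D             ∎
    where
    D = dirCut G₀ U

  dirCutApprox-step : ∀ {G H e T} → NonNegWeights G → 0ℚ ≤ e → 0ℚ ≤ T → T * T * 2ℚ ≤ 1ℚ →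
    DirCutApprox β e G H → DriftFrom₀ G T → DriftFrom₀ H (T + e)
  dirCutApprox-step {G} {H} {e} {T} G-nonNeg 0≤e 0≤T T*T*2≤1 approx =
    drift-step 1≤β 0≤e 0≤T T*T*2≤1
      (dirCut-nonNeg G₀-nonNeg U) (undirCut-nonNeg G₀-nonNeg U) undirCut₀-bound
      (dirCut-nonNeg G-nonNeg U) (dirCut-nonNeg G-nonNeg (compl U))
      (AbsLeScaledSqrt⇒square-≤ (approx U U-proper))
      (subst (λ u → y * y * (β + 1ℚ) ≤ e * e * (d' * u)) (undirCut-compl U)
             (AbsLeScaledSqrt⇒square-≤ (approx (compl U) (ProperNonempty-compl U-proper))))
    where
    d' = dirCut G (compl U)
    y  = dirCut H (compl U) - d'

  dirCutApprox-chain : ∀ k (Gs : Fin (suc k) → Weights n) (ε : Fin k → ℚ) {T} →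
    (∀ i → NonNegWeights (Gs i)) → (∀ i → 0ℚ ≤ ε i) → 0ℚ ≤ T →
    (T + sumFin k ε) * (T + sumFin k ε) * 2ℚ ≤ 1ℚ →
    (∀ i → DirCutApprox β (ε i) (Gs (inject₁ i)) (Gs (suc i))) →
    DriftFrom₀ (Gs zero) T → DriftFrom₀ (Gs (fromℕ k)) (T + sumFin k ε)
  dirCutApprox-chain zero Gs ε {T} _ _ _ _ _ drift =
    subst (DriftFrom₀ (Gs zero)) (sym (+-identityʳ T)) drift
  dirCutApprox-chain (suc k) Gs ε {T} Gs-nonNeg 0≤ε 0≤T small approx drift =
    subst (DriftFrom₀ (Gs (fromℕ (suc k)))) (+-assoc T (ε zero) S)
      (dirCutApprox-chain k (Gs ∘ suc) (ε ∘ suc) (Gs-nonNeg ∘ suc) (0≤ε ∘ suc)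
        (+-mono-≤ 0≤T (0≤ε zero))
        (subst (λ t → t * t * 2ℚ ≤ 1ℚ) (sym (+-assoc T (ε zero) S)) small)
        (approx ∘ suc)
        (dirCutApprox-step (Gs-nonNeg zero) (0≤ε zero) 0≤T
          (p*p*2≤1-antimono 0≤T (≤-by-slack (+-mono-≤ (0≤ε zero) 0≤S) refl) small)
          (approx zero) drift))
    where
    S = sumFin k (ε ∘ suc)
    0≤S : 0ℚ ≤ S
    0≤S = sumFin-nonNeg k (0≤ε ∘ suc)

-- Only εᵢ ≥ 0 and the half w(V∖U,U) ≤ β w(U,V∖U) of the balance condition are needed.
lemma4p9 : ∀ {n : ℕ} (k : ℕ) (Gs : Fin (suc k) → Weights n) (β : ℚ) (ε : Fin k → ℚ) →
    (∀ i → NonNegWeights (Gs i)) →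
    1ℚ ≤ β →
    (∀ i → (0ℚ < ε i) × (ε i < 1ℚ)) →
    (sumFin k ε * sumFin k ε) * 2ℚ ≤ 1ℚ →
    (∀ (i : Fin k) → DirCutApprox β (ε i) (Gs (inject₁ i)) (Gs (Data.Fin.suc i))) →
    BalancedDirCutApprox β (3ℚ * sumFin k ε) (Gs Data.Fin.zero) (Gs (fromℕ k))
lemma4p9 k Gs β ε Gs-nonNeg 1≤β ε-range small approx U U-proper balanced _ =
  drift-bounds (subst (DriftFrom₀ (Gs (fromℕ k))) (+-identityˡ S) drift)
  where
  open Chain 1≤β (Gs-nonNeg zero) U-proper balanced
  S = sumFin k ε
  drift : DriftFrom₀ (Gs (fromℕ k)) (0ℚ + S)
  drift = dirCutApprox-chain k Gs ε Gs-nonNeg (λ i → <⇒≤ (proj₁ (ε-range i))) ≤-refl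
    (subst (λ t → t * t * 2ℚ ≤ 1ℚ) (sym (+-identityˡ S)) small) approx drift-start
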